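{- Let $S=\{\mu,\sigma\}$ with $\mu(0)=01$, $\mu(1)=10$, $\sigma(0)=00$, $\sigma(1)=11$, and let $\mathbf{w}$ be any $S$-adic sequence. Then $|\mathcal{L}^{\mathbf{w}}_n|\le 8n$ for all $n\ge1$.
   Context: For a binary sequence $\mathbf{w}\in\{0,1\}^{\mathbb{N}}$, $\mathcal{L}^{\mathbf{w}}_n$ is the set of factors (contiguous subwords) of $\mathbf{w}$ of length $n$. Given a set $S$ of morphisms of $\{0,1\}^*$, a binary sequence $\mathbf{w}$ is $S$-adic if there exist $(\sigma_n)_{n\ge1}$ with $\sigma_n\in S$ and letters $(a_n)_{n\ge1}$ in $\{0,1\}$ such that $\mathbf{w}=\lim_{n\to\infty}\sigma_1\cdots\sigma_n(a_na_na_n\cdots)$. -}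

module Defs where

open import Data.Bool using (Bool; true; false; not)
open import Data.Nat using (ℕ; zero; suc; _+_; _*_; _≤_)
open import Data.List using (List; map; upTo; length)
open import Data.List.Relation.Unary.Unique.Propositional using (Unique)
open import Data.List.Relation.Unary.All using (All)
open import Data.Product using (∃; ∃-syntax; Σ; _×_)
open import Function using (_∘_)
open import Relation.Binary.PropositionalEquality using (_≡_)

-- Binary letters: 0 = false, 1 = true.  Infinite binary sequences: ℕ → Bool.
Seq : Set
Seq = ℕ → Bool

data Morph : Set where
  μ σ : Morph

-- Both morphisms are 2-uniform: image of a letter b is a word of length 2.
-- letterImg φ b p = the p-th letter (p = false: position 0, p = true: position 1) of φ(b).
-- μ(0)=01, μ(1)=10, σ(0)=00, σ(1)=11.
letterImg : Morph → Bool → Bool → Bool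
letterImg μ b false = b
letterImg μ b true  = not b
letterImg σ b _     = b

half : ℕ → ℕ
half zero = zero
half (suc zero) = zero
half (suc (suc n)) = suc (half n)

odd : ℕ → Bool
odd zero = false
odd (suc n) = not (odd n)

apply : Morph → Seq → Seq
apply φ x k = letterImg φ (x (half k)) (odd k)

comp : (ℕ → Morph) → ℕ → Seq → Seq
comp s zero x = x
comp s (suc n) x = apply (s 0) (comp (s ∘ suc) n x)

constSeq : Bool → Seq
constSeq a _ = a

-- w = lim_{n→∞} σ₁⋯σₙ(aₙaₙaₙ⋯) in the product topology
-- (indices shifted to start at 0: σ_{i+1} = s i, a_n = a n).
IsLimit : (ℕ → Seq) → Seq → Set
IsLimit u w = ∀ k → ∃[ N ] (∀ n → N ≤ n → u n k ≡ w k)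

SAdic : Seq → Set
SAdic w = Σ (ℕ → Morph) λ s → Σ (ℕ → Bool) λ a →
  IsLimit (λ n → comp s n (constSeq (a n))) w

slice : Seq → ℕ → ℕ → List Bool
slice w i n = map (λ j → w (i + j)) (upTo n)

IsFactor : Seq → ℕ → List Bool → Set
IsFactor w n u = ∃[ i ] (u ≡ slice w i n)

-- |L^w_n| ≤ m : every duplicate-free list of length-n factors of w has length ≤ m.
CardFactorsLE : Seq → ℕ → ℕ → Set
CardFactorsLE w n m = ∀ (us : List (List Bool)) → Unique us → All (IsFactor w n) us → length us ≤ m

-- Fix k with n ≤ 2^k ≤ 2n. On any finite window, w agrees with σ₁⋯σ_m(a_m a_m ⋯) = σ₁⋯σ_k(y)
-- for m large, and as σ₁⋯σ_k is 2^k-uniform, a window of length n ≤ 2^k starting in the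
-- q-th block of σ₁⋯σ_k(y) depends only on the letters y_q y_{q+1}. Every two-letter word
-- starts at one of the first four positions of 00110, so each factor of length n of w
-- occurs in σ₁⋯σ_k(00110⋯) at a position below 4·2^k ≤ 8n.
module Submission where

open import Defs
open import Data.Bool using (Bool; true; false)
open import Data.Bool.Properties using (not-involutive)
open import Data.Nat using (ℕ; zero; suc; _+_; _*_; _^_; _≤_; _<_; z≤n; s≤s; z<s; s<s; _⊔_; _≤?_; NonZero)
open import Data.Nat.Properties
open import Data.Nat.DivMod using (_/_; _%_; m≡m%n+[m/n]*n; m%n<n)
open import Data.List using (List; []; _∷_; map; upTo; length)
open import Data.List.Properties using (length-map; length-upTo; length-removeAt′; map-cong-local)
open import Data.List.Relation.Unary.Any using (here; there; index; _─_)
open import Data.List.Relation.Unary.All as All using (All; _∷_)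
open import Data.List.Relation.Unary.All.Properties using (applyUpTo⁺₁)
open import Data.List.Relation.Unary.AllPairs using (_∷_)
open import Data.List.Relation.Unary.Unique.Propositional using (Unique)
open import Data.List.Membership.Propositional using (_∈_)
open import Data.List.Membership.Propositional.Properties using (∈-map⁺; ∈-upTo⁺)
open import Data.Product using (∃-syntax; _×_; _,_)
open import Data.Sum using (inj₁; inj₂)
open import Function using (_∘_)
open import Relation.Nullary using (yes; no; contradiction)
open import Relation.Binary.PropositionalEquality

module _ {A : Set} where

  ∈-─⁺ : ∀ {x y : A} {ys} (x∈ys : x ∈ ys) → y ∈ ys → x ≢ y → y ∈ (ys ─ x∈ys)
  ∈-─⁺ (here refl) (here refl) x≢y = contradiction refl x≢y
  ∈-─⁺ (here _)    (there y∈ys) _   = y∈ys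
  ∈-─⁺ (there _)   (here refl) _    = here refl
  ∈-─⁺ (there x∈ys) (there y∈ys) x≢y = there (∈-─⁺ x∈ys y∈ys x≢y)

  Unique⇒length≤ : ∀ {xs ys : List A} → Unique xs → All (_∈ ys) xs → length xs ≤ length ys
  Unique⇒length≤ {[]}          _             _              = z≤n
  Unique⇒length≤ {x ∷ xs} {ys} (x∉xs ∷ uniq) (x∈ys ∷ xs⊆ys) = begin
    suc (length xs)          ≤⟨ s≤s (Unique⇒length≤ uniq xs⊆ys─x) ⟩
    suc (length (ys ─ x∈ys)) ≡⟨ length-removeAt′ ys (index x∈ys) ⟨
    length ys                ∎
    where
    open ≤-Reasoning
    xs⊆ys─x : All (_∈ (ys ─ x∈ys)) xs
    xs⊆ys─x = All.zipWith (λ (y∈ys , x≢y) → ∈-─⁺ x∈ys y∈ys x≢y) (xs⊆ys , x∉xs)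

slice-cong : ∀ (w v : Seq) i p n → (∀ {j} → j < n → w (i + j) ≡ v (p + j)) →
             slice w i n ≡ slice v p n
slice-cong w v i p n agree = map-cong-local (applyUpTo⁺₁ _ n agree)

earlyOccurrences⇒CardFactorsLE : ∀ (w v : Seq) n P →
  (∀ {u} → IsFactor w n u → ∃[ p ] p < P × u ≡ slice v p n) → CardFactorsLE w n P
earlyOccurrences⇒CardFactorsLE w v n P occurs us uniq factors = begin
  length us                                 ≤⟨ Unique⇒length≤ uniq (All.map early factors) ⟩
  length (map (λ p → slice v p n) (upTo P)) ≡⟨ length-map _ (upTo P) ⟩
  length (upTo P)                           ≡⟨ length-upTo P ⟩
  P                                         ∎
  where
  open ≤-Reasoning
  early : ∀ {u} → IsFactor w n u → u ∈ map (λ p → slice v p n) (upTo P)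
  early factor with p , p<P , refl ← occurs factor = ∈-map⁺ _ (∈-upTo⁺ p<P)

power-of-two-between : ∀ n → 1 ≤ n → ∃[ k ] n ≤ 2 ^ k × 2 ^ k ≤ 2 * n
power-of-two-between (suc zero)    _ = 0 , s≤s z≤n , s≤s z≤n
power-of-two-between (suc (suc m)) _
  with k , 1+m≤2^k , 2^k≤2+2m ← power-of-two-between (suc m) (s≤s z≤n)
  with suc (suc m) ≤? 2 ^ k
... | yes 2+m≤2^k = k , 2+m≤2^k , ≤-trans 2^k≤2+2m (*-monoʳ-≤ 2 (n≤1+n (suc m)))
... | no  2+m≰2^k = suc k , 2+m≤2^[1+k] , *-monoʳ-≤ 2 (≤-trans 2^k≤1+m (n≤1+n (suc m)))
  where
  2^k≤1+m : 2 ^ k ≤ suc m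
  2^k≤1+m = ≤-pred (≰⇒> 2+m≰2^k)
  2+m≤2^[1+k] : suc (suc m) ≤ 2 ^ suc k
  2+m≤2^[1+k] = +-mono-≤ (m^n>0 2 k) (≤-trans 1+m≤2^k (m≤m+n (2 ^ k) 0))

shift : ℕ → Seq → Seq
shift q x t = x (q + t)

half-double+ : ∀ c m → half (c + c + m) ≡ c + half m
half-double+ zero    m = refl
half-double+ (suc c) m rewrite +-suc c c = cong suc (half-double+ c m)

odd-double+ : ∀ c m → odd (c + c + m) ≡ odd m
odd-double+ zero    m = refl
odd-double+ (suc c) m rewrite +-suc c c | odd-double+ c m = not-involutive (odd m)

*-double : ∀ q c → q * (2 * c) ≡ q * c + q * c
*-double q c = trans (cong (q *_) (cong (c +_) (+-identityʳ c))) (*-distribˡ-+ q c c)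

half-< : ∀ {m} c → m < c + c → half m < c
half-< {zero}        (suc c) _                = z<s
half-< {suc zero}    (suc c) _                = z<s
half-< {suc (suc m)} (suc c) (s<s 2+m≤c+1+c) =
  s<s (half-< c (≤-pred (subst (suc (suc m) ≤_) (+-suc c c) 2+m≤c+1+c)))

apply-cong : ∀ φ (x y : Seq) m → x (half m) ≡ y (half m) → apply φ x m ≡ apply φ y m
apply-cong φ x y m eq = cong (λ b → letterImg φ b (odd m)) eq

apply-shift : ∀ φ (x : Seq) c m → apply φ x (c + c + m) ≡ apply φ (shift c x) m
apply-shift φ x c m = cong₂ (letterImg φ) (cong x (half-double+ c m)) (odd-double+ c m)

comp-+ : ∀ s k l (x : Seq) m → comp s (k + l) x m ≡ comp s k (comp (λ t → s (k + t)) l x) m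
comp-+ s zero    l x m = refl
comp-+ s (suc k) l x m =
  apply-cong (s 0) (comp (s ∘ suc) (k + l) x) (comp (s ∘ suc) k (comp (λ t → s (suc k + t)) l x)) m
    (comp-+ (s ∘ suc) k l x (half m))

comp-shift : ∀ s k (x : Seq) q m → comp s k x (q * 2 ^ k + m) ≡ comp s k (shift q x) m
comp-shift s zero    x q m = cong (λ t → x (t + m)) (*-identityʳ q)
comp-shift s (suc k) x q m = begin
  apply (s 0) X (q * 2 ^ suc k + m)  ≡⟨ cong (λ i → apply (s 0) X (i + m)) (*-double q (2 ^ k)) ⟩
  apply (s 0) X (c + c + m)          ≡⟨ apply-shift (s 0) X c m ⟩
  apply (s 0) (shift c X) m          ≡⟨ apply-cong (s 0) (shift c X) X′ m (comp-shift (s ∘ suc) k x q (half m)) ⟩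
  apply (s 0) X′ m                   ∎
  where
  open ≡-Reasoning
  X = comp (s ∘ suc) k x
  X′ = comp (s ∘ suc) k (shift q x)
  c = q * 2 ^ k

comp-cong-< : ∀ s k {x y : Seq} T → (∀ {t} → t < T → x t ≡ y t) →
              ∀ {m} → m < T * 2 ^ k → comp s k x m ≡ comp s k y m
comp-cong-< s zero    T agree m<T = agree (subst (_ <_) (*-identityʳ T) m<T)
comp-cong-< s (suc k) {x} {y} T agree {m} m<T*2^[1+k] =
  apply-cong (s 0) (comp (s ∘ suc) k x) (comp (s ∘ suc) k y) m
    (comp-cong-< (s ∘ suc) k T agree (half-< (T * 2 ^ k) m<2T*2^k))
  where
  m<2T*2^k : m < T * 2 ^ k + T * 2 ^ k
  m<2T*2^k = subst (m <_) (*-double T (2 ^ k)) m<T*2^[1+k]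

IsLimit-window : ∀ {u : ℕ → Seq} {w} → IsLimit u w → ∀ i n →
                 ∃[ M ] (∀ m → M ≤ m → ∀ {j} → j < n → u m (i + j) ≡ w (i + j))
IsLimit-window lim i zero    = 0 , λ _ _ ()
IsLimit-window {u} {w} lim i (suc n)
  with M , below-n ← IsLimit-window lim i n | N , at-n ← lim (i + n)
  = M ⊔ N , agree
  where
  agree : ∀ m → M ⊔ N ≤ m → ∀ {j} → j < suc n → u m (i + j) ≡ w (i + j)
  agree m M⊔N≤m j<1+n with m≤n⇒m<n∨m≡n (≤-pred j<1+n)
  ... | inj₁ j<n  = below-n m (≤-trans (m≤m⊔n M N) M⊔N≤m) j<n
  ... | inj₂ refl = at-n m (≤-trans (m≤n⊔m M N) M⊔N≤m)

SAdic-window : ∀ (s : ℕ → Morph) (a : ℕ → Bool) {w} →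
               IsLimit (λ m → comp s m (constSeq (a m))) w → ∀ k i n → ∃[ y ] slice w i n ≡ slice (comp s k y) i n
SAdic-window s a {w} lim k i n with M , agree ← IsLimit-window lim i n =
  y , slice-cong w (comp s k y) i i n λ {j} j<n → begin
    w (i + j)                                     ≡⟨ agree (k + M) (m≤n+m M k) j<n ⟨
    comp s (k + M) (constSeq (a (k + M))) (i + j) ≡⟨ comp-+ s k M _ (i + j) ⟩
    comp s k y (i + j)                            ∎
  where
  open ≡-Reasoning
  y = comp (λ t → s (k + t)) M (constSeq (a (k + M)))

deBruijn : Seq
deBruijn 2 = true
deBruijn 3 = true
deBruijn _ = false

<2-elim : ∀ (P : ℕ → Set) → P 0 → P 1 → ∀ {t} → t < 2 → P t
<2-elim P p₀ p₁ {zero}        _ = p₀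
<2-elim P p₀ p₁ {suc zero}    _ = p₁
<2-elim P p₀ p₁ {suc (suc _)} (s<s (s<s ()))

deBruijn-window : ∀ (x : Seq) → ∃[ d ] d < 4 × (∀ {t} → t < 2 → deBruijn (d + t) ≡ x t)
deBruijn-window x with x 0 in e₀ | x 1 in e₁
... | false | false = 0 , z<s ,                 <2-elim (λ t → deBruijn (0 + t) ≡ x t) (sym e₀) (sym e₁)
... | false | true  = 1 , s<s z<s ,             <2-elim (λ t → deBruijn (1 + t) ≡ x t) (sym e₀) (sym e₁)
... | true  | true  = 2 , s<s (s<s z<s) ,       <2-elim (λ t → deBruijn (2 + t) ≡ x t) (sym e₀) (sym e₁)
... | true  | false = 3 , s<s (s<s (s<s z<s)) , <2-elim (λ t → deBruijn (3 + t) ≡ x t) (sym e₀) (sym e₁)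

comp-slice-two-letters : ∀ s k (x x' : Seq) q d r n → r + n ≤ 2 * 2 ^ k →
  (∀ {t} → t < 2 → shift q x t ≡ shift d x' t) →
  slice (comp s k x) (q * 2 ^ k + r) n ≡ slice (comp s k x') (d * 2 ^ k + r) n
comp-slice-two-letters s k x x' q d r n r+n≤2K agree =
  slice-cong (comp s k x) (comp s k x') _ _ n λ {j} j<n → begin
    comp s k x (q * K + r + j)      ≡⟨ cong (comp s k x) (+-assoc (q * K) r j) ⟩
    comp s k x (q * K + (r + j))    ≡⟨ comp-shift s k x q (r + j) ⟩
    comp s k (shift q x) (r + j)    ≡⟨ comp-cong-< s k 2 agree (≤-trans (+-monoʳ-< r j<n) r+n≤2K) ⟩
    comp s k (shift d x') (r + j)   ≡⟨ comp-shift s k x' d (r + j) ⟨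
    comp s k x' (d * K + (r + j))   ≡⟨ cong (comp s k x') (+-assoc (d * K) r j) ⟨
    comp s k x' (d * K + r + j)     ∎
  where
  open ≡-Reasoning
  K = 2 ^ k

comp-slice-occurs-early : ∀ s k (y : Seq) i n → n ≤ 2 ^ k →
  ∃[ p ] p < 4 * 2 ^ k × slice (comp s k y) i n ≡ slice (comp s k deBruijn) p n
comp-slice-occurs-early s k y i n n≤K = occurrence (deBruijn-window (shift q y))
  where
  K = 2 ^ k
  instance
    K≢0 : NonZero K
    K≢0 = m^n≢0 2 k
  q = i / K
  r = i % K
  r<K : r < K
  r<K = m%n<n i K
  i≡qK+r : i ≡ q * K + r
  i≡qK+r = trans (m≡m%n+[m/n]*n i K) (+-comm r (q * K))
  r+n≤2K : r + n ≤ 2 * K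
  r+n≤2K = +-mono-≤ (<⇒≤ r<K) (≤-trans n≤K (m≤m+n K 0))
  position-bound : ∀ {d} → d < 4 → d * K + r < 4 * K
  position-bound {d} d<4 = begin-strict
    d * K + r <⟨ +-monoʳ-< (d * K) r<K ⟩
    d * K + K ≡⟨ +-comm (d * K) K ⟩
    suc d * K ≤⟨ *-monoˡ-≤ K d<4 ⟩
    4 * K     ∎
    where open ≤-Reasoning
  occurrence : ∃[ d ] d < 4 × (∀ {t} → t < 2 → deBruijn (d + t) ≡ shift q y t) →
               ∃[ p ] p < 4 * K × slice (comp s k y) i n ≡ slice (comp s k deBruijn) p n
  occurrence (d , d<4 , covers) = d * K + r , position-bound d<4 , (begin
    slice (comp s k y) i n                  ≡⟨ cong (λ i → slice (comp s k y) i n) i≡qK+r ⟩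
    slice (comp s k y) (q * K + r) n
      ≡⟨ comp-slice-two-letters s k y deBruijn q d r n r+n≤2K (sym ∘ covers) ⟩
    slice (comp s k deBruijn) (d * K + r) n ∎)
    where open ≡-Reasoning

proposition9p3 : ∀ (w : Seq) → SAdic w → ∀ (n : ℕ) → 1 ≤ n → CardFactorsLE w n (8 * n)
proposition9p3 w (s , a , lim) n 1≤n us uniq factors
  with k , n≤2^k , 2^k≤2n ← power-of-two-between n 1≤n = begin
    length us   ≤⟨ earlyOccurrences⇒CardFactorsLE w σ[dB] n (4 * 2 ^ k) occurs-early us uniq factors ⟩
    4 * 2 ^ k   ≤⟨ *-monoʳ-≤ 4 2^k≤2n ⟩
    4 * (2 * n) ≡⟨ *-assoc 4 2 n ⟨
    8 * n       ∎
  where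
  open ≤-Reasoning
  σ[dB] = comp s k deBruijn
  occurs-early : ∀ {u} → IsFactor w n u → ∃[ p ] p < 4 * 2 ^ k × u ≡ slice σ[dB] p n
  occurs-early (i , refl)
    with y , w≡σ[y] ← SAdic-window s a lim k i n
    with p , p<4K , σ[y]≡σ[dB] ← comp-slice-occurs-early s k y i n n≤2^k
    = p , p<4K , trans w≡σ[y] σ[y]≡σ[dB]
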